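{- If $W$ is a nonempty world of $\mathrm{LO}^{\mathrm{mon}}$, then for every language $\mathcal L$ with $\mathcal L_{\le}\subseteq\mathcal L\subseteq\mathcal L^{\Diamond}_{\le}(W)$, one has $\mathrm{Val}_{\mathrm{LO}^{\mathrm{mon}}}(W,\mathcal L)\subseteq\mathsf{S5}$.
   Context: Linear orders are total orders, possibly empty. $\mathrm{LO}^{\mathrm{mon}}$ is the category of linear orders and monotone maps. $\mathcal L_{\le}=\{\le\}$; $\mathcal L^{\Diamond}_{\le}(W)$ is its modal extension (operators $\Diamond,\Box$) with constants naming elements of $W$ (transported along morphisms). Modal satisfaction: $U\models\Diamond\varphi[\nu]$ iff there is a morphism $f:U\to V$ with $V\models\varphi[f\circ\nu]$; $\Box$ dually. $\mathrm{Val}(W,\Gamma)$ is the set of propositional modal formulas $\psi(p_0,\dots,p_n)$ all of whose substitution instances $\psi(\varphi_0,\dots,\varphi_n)$ with $\varphi_i\in\Gamma$ hold at $W$. $\mathsf{S5}$ is the normal modal logic axiomatized by $\Box p\to p$, $\Box p\to\Box\Box p$ and $\Diamond\Box p\to p$. -}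

module Defs where

open import Level using (Level; 0ℓ; Lift) renaming (suc to lsuc)
open import Data.Nat using (ℕ; suc)
open import Data.Fin using (Fin; zero; suc)
open import Data.Bool using (Bool; true; false; not) renaming (_∧_ to _&&_; _∨_ to _||_)
open import Data.Empty using (⊥)
open import Data.Product using (Σ; _×_; _,_)
open import Data.Sum using (_⊎_)
open import Function using (_∘_)
open import Relation.Binary.PropositionalEquality using (_≡_)
open import Relation.Binary.Structures using (IsTotalOrder)
open import Relation.Nullary using (¬_)

record LinOrd : Set₁ where
  field
    Carrier      : Set
    _≤_          : Carrier → Carrier → Set
    isTotalOrder : IsTotalOrder _≡_ _≤_

open LinOrd public

record Mono (U V : LinOrd) : Set where
  field
    fun  : Carrier U → Carrier V
    mono : ∀ {x y} → _≤_ U x y → _≤_ V (fun x) (fun y)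

open Mono public

idMono : (U : LinOrd) → Mono U U
idMono U = record { fun = λ x → x ; mono = λ p → p }

_∘M_ : {U V X : LinOrd} → Mono V X → Mono U V → Mono U X
g ∘M f = record { fun = fun g ∘ fun f ; mono = λ p → mono g (mono f p) }

-- The language L^◇_≤(C): first-order logic with equality over {≤},
-- constants from C, and modal operators ◇, □.  Variables are
-- de Bruijn indices; Form C n has n free variables.

data Term (C : Set) (n : ℕ) : Set where
  var : Fin n → Term C n
  con : C → Term C n

infixr 5 _⇒'_
data Form (C : Set) (n : ℕ) : Set where
  _≤'_ _≐'_       : Term C n → Term C n → Form C n
  ⊥'              : Form C n
  ¬'_             : Form C n → Form C n
  _∧'_ _∨'_ _⇒'_  : Form C n → Form C n → Form C n
  ∀' ∃'           : Form C (suc n) → Form C n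
  ◇' □'           : Form C n → Form C n

Sentence : LinOrd → Set
Sentence W = Form (Carrier W) 0

data PlainTerm {C : Set} {n : ℕ} : Term C n → Set where
  var : (i : Fin n) → PlainTerm (var i)

data Plain {C : Set} : {n : ℕ} → Form C n → Set where
  ≤-p  : ∀ {n} {s t : Term C n} → PlainTerm s → PlainTerm t → Plain (s ≤' t)
  ≐-p  : ∀ {n} {s t : Term C n} → PlainTerm s → PlainTerm t → Plain (s ≐' t)
  ⊥-p  : ∀ {n} → Plain {C} {n} ⊥'
  ¬-p  : ∀ {n} {φ : Form C n} → Plain φ → Plain (¬' φ)
  ∧-p  : ∀ {n} {φ ψ : Form C n} → Plain φ → Plain ψ → Plain (φ ∧' ψ)
  ∨-p  : ∀ {n} {φ ψ : Form C n} → Plain φ → Plain ψ → Plain (φ ∨' ψ)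
  ⇒-p  : ∀ {n} {φ ψ : Form C n} → Plain φ → Plain ψ → Plain (φ ⇒' ψ)
  ∀-p  : ∀ {n} {φ : Form C (suc n)} → Plain φ → Plain (∀' φ)
  ∃-p  : ∀ {n} {φ : Form C (suc n)} → Plain φ → Plain (∃' φ)

-- Semantics.  A world is a linear order U together with a morphism
-- g : W → U along which the constants (elements of W) are transported.

extend : {A : Set} {n : ℕ} → A → (Fin n → A) → Fin (suc n) → A
extend a ν zero    = a
extend a ν (suc i) = ν i

module _ (W : LinOrd) where

  evalT : ∀ {n} (U : LinOrd) → Mono W U → (Fin n → Carrier U) → Term (Carrier W) n → Carrier U
  evalT U g ν (var i) = ν i
  evalT U g ν (con c) = fun g c

  Sat : ∀ {n} (U : LinOrd) → Mono W U → Form (Carrier W) n → (Fin n → Carrier U) → Set₁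
  Sat U g (s ≤' t) ν = Lift _ (_≤_ U (evalT U g ν s) (evalT U g ν t))
  Sat U g (s ≐' t) ν = Lift _ (evalT U g ν s ≡ evalT U g ν t)
  Sat U g ⊥' ν       = Lift _ ⊥
  Sat U g (¬' φ) ν   = ¬ Sat U g φ ν
  Sat U g (φ ∧' ψ) ν = Sat U g φ ν × Sat U g ψ ν
  Sat U g (φ ∨' ψ) ν = Sat U g φ ν ⊎ Sat U g ψ ν
  Sat U g (φ ⇒' ψ) ν = Sat U g φ ν → Sat U g ψ ν
  Sat U g (∀' φ) ν   = (a : Carrier U) → Sat U g φ (extend a ν)
  Sat U g (∃' φ) ν   = Σ (Carrier U) λ a → Sat U g φ (extend a ν)
  Sat U g (◇' φ) ν   = Σ LinOrd λ V → Σ (Mono U V) λ f → Sat V (f ∘M g) φ (fun f ∘ ν)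
  Sat U g (□' φ) ν   = (V : LinOrd) (f : Mono U V) → Sat V (f ∘M g) φ (fun f ∘ ν)

  HoldsAt : Sentence W → Set₁
  HoldsAt φ = Sat W (idMono W) φ (λ ())

infixr 5 _⇒ᵖ_
data PForm : Set where
  p              : ℕ → PForm
  ⊥ᵖ             : PForm
  ¬ᵖ_            : PForm → PForm
  _∧ᵖ_ _∨ᵖ_ _⇒ᵖ_ : PForm → PForm → PForm
  □ᵖ ◇ᵖ          : PForm → PForm

substP : {C : Set} → (ℕ → Form C 0) → PForm → Form C 0
substP σ (p i)    = σ i
substP σ ⊥ᵖ       = ⊥'
substP σ (¬ᵖ φ)   = ¬' (substP σ φ)
substP σ (φ ∧ᵖ ψ) = substP σ φ ∧' substP σ ψ
substP σ (φ ∨ᵖ ψ) = substP σ φ ∨' substP σ ψ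
substP σ (φ ⇒ᵖ ψ) = substP σ φ ⇒' substP σ ψ
substP σ (□ᵖ φ)   = □' (substP σ φ)
substP σ (◇ᵖ φ)   = ◇' (substP σ φ)

Val : (W : LinOrd) → (Sentence W → Set) → PForm → Set₁
Val W Γ ψ = (σ : ℕ → Sentence W) → (∀ i → Γ (σ i)) → HoldsAt W (substP σ ψ)

beval : (PForm → Bool) → PForm → Bool
beval v (p i)    = v (p i)
beval v ⊥ᵖ       = false
beval v (¬ᵖ φ)   = not (beval v φ)
beval v (φ ∧ᵖ ψ) = beval v φ && beval v ψ
beval v (φ ∨ᵖ ψ) = beval v φ || beval v ψ
beval v (φ ⇒ᵖ ψ) = not (beval v φ) || beval v ψ
beval v (□ᵖ φ)   = v (□ᵖ φ)
beval v (◇ᵖ φ)   = v (◇ᵖ φ)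

Tautology : PForm → Set
Tautology ψ = (v : PForm → Bool) → beval v ψ ≡ true

data S5 : PForm → Set where
  taut  : ∀ {ψ} → Tautology ψ → S5 ψ
  axK   : ∀ {φ ψ} → S5 (□ᵖ (φ ⇒ᵖ ψ) ⇒ᵖ (□ᵖ φ ⇒ᵖ □ᵖ ψ))
  dual₁ : ∀ {φ} → S5 (◇ᵖ φ ⇒ᵖ ¬ᵖ □ᵖ (¬ᵖ φ))
  dual₂ : ∀ {φ} → S5 (¬ᵖ □ᵖ (¬ᵖ φ) ⇒ᵖ ◇ᵖ φ)
  axT   : ∀ {φ} → S5 (□ᵖ φ ⇒ᵖ φ)
  ax4   : ∀ {φ} → S5 (□ᵖ φ ⇒ᵖ □ᵖ (□ᵖ φ))
  axB   : ∀ {φ} → S5 (◇ᵖ (□ᵖ φ) ⇒ᵖ φ)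
  mp    : ∀ {φ ψ} → S5 (φ ⇒ᵖ ψ) → S5 φ → S5 ψ
  nec   : ∀ {φ} → S5 φ → S5 (□ᵖ φ)

{-# OPTIONS --safe #-}

-- If ψ is not an S5 theorem, completeness of S5 for valuations that are consistent on the
-- finitely many atoms Γ⁺ of ψ yields such a valuation v₀ refuting ψ.  The consistent valuations
-- agreeing with v₀ on the boxed atoms form a finite S5 cluster, listed in slots 0, …, K.  A linear
-- order is sent to the slot given by its number of elements (minus one, capped at K), which plain
-- sentences can express, with the slot of W exchanged for the slot of v₀.  Every order maps by a
-- constant map into a finite chain of any length, so every world of the cluster is visible from
-- every order, which is what the truth lemma needs for □ and ◇.  Substituting for p i the plain
-- sentence "the world in my slot makes p i true" therefore refutes ψ at W.

module Submission where

open import Defs hiding (_≤_)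
open import Level using (0ℓ; Lift; lift; lower) renaming (suc to lsuc)
open import Axiom.ExcludedMiddle using (ExcludedMiddle)
open import Data.Bool using (Bool; true; false; not; T; _∧_; _∨_)
open import Data.Bool.Properties using (∧-conicalˡ; ∧-conicalʳ; T-≡; T-not-≡; T-∧; T-∨)
open import Data.Empty using (⊥-elim)
open import Data.Fin as Fin using (Fin; zero; suc; toℕ; fromℕ; fromℕ<; inject₁)
open import Data.Fin.Properties
  using (≤-isTotalOrder; toℕ-fromℕ; toℕ-fromℕ<; toℕ-inject₁; toℕ-injective; toℕ≤pred[n]; toℕ<n)
open import Data.Fin.Permutation.Components using (transpose; transpose-inverse)
open import Data.List using (List; []; _∷_; _++_; map; length; lookup)
open import Data.List.Properties using (∷-injective)
open import Data.List.Membership.Propositional using (_∈_)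
open import Data.List.Membership.Propositional.Properties using (∈-++⁺ˡ; ∈-++⁺ʳ; ∈-++⁻; ∈-map⁺)
open import Data.List.Relation.Binary.Subset.Propositional using (_⊆_)
open import Data.List.Relation.Binary.Subset.Propositional.Properties using (⊆-refl; ∈-∷⁺ʳ; xs⊆x∷xs)
open import Data.List.Relation.Unary.Any using (here; there; index)
open import Data.List.Relation.Unary.Any.Properties using (lookup-index)
open import Data.Nat using (ℕ; zero; suc; _≤_; z≤n; s≤s; s≤s⁻¹)
open import Data.Nat.Properties using (≤-trans; ≤-antisym; ≤-reflexive; ≰⇒>; <⇒≱; <-trans; <-≤-trans)
open import Data.Product using (Σ; _×_; _,_; proj₁; proj₂; map₂)
open import Data.Product.Function.NonDependent.Propositional using (_×-⇔_)
open import Data.Sum using (inj₁; inj₂; [_,_])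
open import Data.Sum.Function.Propositional using (_⊎-⇔_)
open import Data.Unit using (tt)
open import Function using (_∘_; _⇔_; mk⇔; Equivalence)
open import Function.Construct.Composition using (_⇔-∘_)
open import Function.Construct.Symmetry using (⇔-sym)
open import Function.Related.TypeIsomorphisms using (→-cong-⇔; ¬-cong-⇔)
open import Relation.Binary.PropositionalEquality
  using (_≡_; refl; sym; trans; cong; cong₂; subst; module ≡-Reasoning)
open import Relation.Nullary using (¬_; Dec; yes; no)
open import Relation.Nullary.Decidable using (map′; decidable-stable; dec-true; T?)

open Equivalence using (to; from)

transpose-self : ∀ {n} (i j : Fin n) → transpose i j i ≡ j
transpose-self i j rewrite dec-true (i Fin.≟ i) refl = refl

++-⊆ : ∀ {A : Set} {xs ys zs : List A} → xs ⊆ zs → ys ⊆ zs → xs ++ ys ⊆ zs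
++-⊆ {xs = xs} h₁ h₂ = [ h₁ , h₂ ] ∘ ∈-++⁻ xs

Valuation : Set
Valuation = PForm → Bool

variable
  a b c d φ χ θ : PForm
  Δ Γ : List PForm
  v v′ w : Valuation

infixr 5 _⇒ᵇ_
_⇒ᵇ_ : Bool → Bool → Bool
x ⇒ᵇ y = not x ∨ y

T-⇒ᵇ : ∀ {x y} → T (x ⇒ᵇ y) ⇔ (T x → T y)
T-⇒ᵇ {true}  {true}  = mk⇔ (λ _ _ → tt) (λ _ → tt)
T-⇒ᵇ {true}  {false} = mk⇔ (λ ()) (λ f → f tt)
T-⇒ᵇ {false}         = mk⇔ (λ _ ()) (λ _ → tt)

T-not : ∀ {x} → T (not x) ⇔ (¬ T x)
T-not {true}  = mk⇔ (λ ()) (λ f → f tt)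
T-not {false} = mk⇔ (λ _ ()) (λ _ → tt)

T-stable : ∀ x → ¬ ¬ T x → T x
T-stable x = decidable-stable (T? x)

-- Propositional reasoning in S5

-- A tautology schema in n letters is proved by evaluating its truth table (the refl passed to
-- validₙ-sound) and instantiating the letters with the truth values of the formulas.
valid₁ : (Bool → Bool) → Bool
valid₁ f = f true ∧ f false

valid₂ : (Bool → Bool → Bool) → Bool
valid₂ f = valid₁ λ x → valid₁ (f x)

valid₃ : (Bool → Bool → Bool → Bool) → Bool
valid₃ f = valid₁ λ x → valid₂ (f x)

valid₄ : (Bool → Bool → Bool → Bool → Bool) → Bool
valid₄ f = valid₁ λ x → valid₃ (f x)

valid₁-sound : ∀ f → valid₁ f ≡ true → ∀ x → f x ≡ true
valid₁-sound f h true  = ∧-conicalˡ (f true) (f false) h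
valid₁-sound f h false = ∧-conicalʳ (f true) (f false) h

valid₂-sound : ∀ f → valid₂ f ≡ true → ∀ x y → f x y ≡ true
valid₂-sound f h x = valid₁-sound (f x) (valid₁-sound (λ x → valid₁ (f x)) h x)

valid₃-sound : ∀ f → valid₃ f ≡ true → ∀ x y z → f x y z ≡ true
valid₃-sound f h x = valid₂-sound (f x) (valid₁-sound (λ x → valid₂ (f x)) h x)

valid₄-sound : ∀ f → valid₄ f ≡ true → ∀ x y z u → f x y z u ≡ true
valid₄-sound f h x = valid₃-sound (f x) (valid₁-sound (λ x → valid₃ (f x)) h x)

⊤ᵖ : PForm
⊤ᵖ = ¬ᵖ ⊥ᵖ

¬¬-elim : S5 (¬ᵖ ¬ᵖ a ⇒ᵖ a)
¬¬-elim {a} = taut λ v → valid₁-sound (λ x → not (not x) ⇒ᵇ x) refl (beval v a)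

weaken : S5 b → S5 (a ⇒ᵖ b)
weaken {b} {a} = mp (taut λ v → valid₂-sound (λ x y → y ⇒ᵇ x ⇒ᵇ y) refl (beval v a) (beval v b))

exfalso : S5 (¬ᵖ a) → S5 (a ⇒ᵖ b)
exfalso {a} {b} = mp (taut λ v → valid₂-sound (λ x y → not x ⇒ᵇ x ⇒ᵇ y) refl (beval v a) (beval v b))

contraposition : S5 (a ⇒ᵖ b) → S5 (¬ᵖ b ⇒ᵖ ¬ᵖ a)
contraposition {a} {b} =
  mp (taut λ v → valid₂-sound (λ x y → (x ⇒ᵇ y) ⇒ᵇ not y ⇒ᵇ not x) refl (beval v a) (beval v b))

refute : S5 (a ⇒ᵖ ¬ᵖ b) → S5 b → S5 (¬ᵖ a)
refute {a} {b} h =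
  mp (mp (taut λ v → valid₂-sound (λ x y → (x ⇒ᵇ not y) ⇒ᵇ y ⇒ᵇ not x) refl (beval v a) (beval v b)) h)

∧-intro : S5 (a ⇒ᵖ b ⇒ᵖ a ∧ᵖ b)
∧-intro {a} {b} = taut λ v → valid₂-sound (λ x y → x ⇒ᵇ y ⇒ᵇ x ∧ y) refl (beval v a) (beval v b)

⇒-trans : S5 (a ⇒ᵖ b) → S5 (b ⇒ᵖ c) → S5 (a ⇒ᵖ c)
⇒-trans {a} {b} {c} h =
  mp (mp (taut λ v → valid₃-sound (λ x y z → (x ⇒ᵇ y) ⇒ᵇ (y ⇒ᵇ z) ⇒ᵇ x ⇒ᵇ z) refl
                                   (beval v a) (beval v b) (beval v c)) h)

uncurry : S5 (a ⇒ᵖ b ⇒ᵖ c) → S5 (a ∧ᵖ b ⇒ᵖ c)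
uncurry {a} {b} {c} =
  mp (taut λ v → valid₃-sound (λ x y z → (x ⇒ᵇ y ⇒ᵇ z) ⇒ᵇ x ∧ y ⇒ᵇ z) refl
                              (beval v a) (beval v b) (beval v c))

by-cases : S5 (a ∧ᵖ b ⇒ᵖ c) → S5 ((¬ᵖ a) ∧ᵖ b ⇒ᵖ c) → S5 (b ⇒ᵖ c)
by-cases {a} {b} {c} h =
  mp (mp (taut λ v → valid₃-sound (λ x y z → (x ∧ y ⇒ᵇ z) ⇒ᵇ (not x ∧ y ⇒ᵇ z) ⇒ᵇ y ⇒ᵇ z) refl
                                   (beval v a) (beval v b) (beval v c)) h)

∧-mono : S5 (a ⇒ᵖ c) → S5 (b ⇒ᵖ d) → S5 (a ∧ᵖ b ⇒ᵖ c ∧ᵖ d)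
∧-mono {a} {c} {b} {d} h =
  mp (mp (taut λ v → valid₄-sound (λ x y z u → (x ⇒ᵇ y) ⇒ᵇ (z ⇒ᵇ u) ⇒ᵇ x ∧ z ⇒ᵇ y ∧ u) refl
                                   (beval v a) (beval v c) (beval v b) (beval v d)) h)

□-mono : S5 (a ⇒ᵖ b) → S5 (□ᵖ a ⇒ᵖ □ᵖ b)
□-mono h = mp axK (nec h)

◇-mono : S5 (a ⇒ᵖ b) → S5 (◇ᵖ a ⇒ᵖ ◇ᵖ b)
◇-mono h = ⇒-trans dual₁ (⇒-trans (contraposition (□-mono (contraposition h))) dual₂)

ax5 : S5 (¬ᵖ □ᵖ a ⇒ᵖ □ᵖ (¬ᵖ □ᵖ a))
ax5 = ⇒-trans (contraposition (⇒-trans dual₂ (⇒-trans (◇-mono ax4) axB))) ¬¬-elim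

□-∧ : S5 (□ᵖ a ∧ᵖ □ᵖ b ⇒ᵖ □ᵖ (a ∧ᵖ b))
□-∧ = uncurry (⇒-trans (□-mono ∧-intro) axK)

⇒□-∧ : S5 (a ⇒ᵖ □ᵖ a) → S5 (b ⇒ᵖ □ᵖ b) → S5 (a ∧ᵖ b ⇒ᵖ □ᵖ (a ∧ᵖ b))
⇒□-∧ ha hb = ⇒-trans (∧-mono ha hb) □-∧

-- Consistent valuations

lit : PForm → Bool → PForm
lit a true  = a
lit a false = ¬ᵖ a

conjLits : List PForm → List Bool → PForm
conjLits []      []       = ⊤ᵖ
conjLits (a ∷ Δ) (b ∷ bs) = lit a b ∧ᵖ conjLits Δ bs
conjLits _       _        = ⊥ᵖ

typeOf : List PForm → Valuation → List Bool
typeOf Δ v = map (beval v) Δ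

Consistent : List PForm → Valuation → Set
Consistent Δ v = ¬ S5 (¬ᵖ conjLits Δ (typeOf Δ v))

lit-true : ∀ {b} → T (beval v (lit a b)) → beval v a ≡ b
lit-true {b = true}  = to T-≡
lit-true {b = false} = to T-not-≡

lit-typeOf : ∀ v a → T (beval v (lit a (beval v a)))
lit-typeOf v a with beval v a in eq
... | true  = from T-≡ eq
... | false = from T-not-≡ eq

conjLits-true : ∀ Δ bs → T (beval v (conjLits Δ bs)) → typeOf Δ v ≡ bs
conjLits-true []      []       _ = refl
conjLits-true (a ∷ Δ) (b ∷ bs) t =
  cong₂ _∷_ (lit-true (proj₁ (to T-∧ t))) (conjLits-true Δ bs (proj₂ (to T-∧ t)))

conjLits-typeOf : ∀ v Δ → T (beval v (conjLits Δ (typeOf Δ v)))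
conjLits-typeOf v []      = tt
conjLits-typeOf v (a ∷ Δ) = from T-∧ (lit-typeOf v a , conjLits-typeOf v Δ)

allTypes : List PForm → List (List Bool)
allTypes []      = [] ∷ []
allTypes (_ ∷ Δ) = map (true ∷_) (allTypes Δ) ++ map (false ∷_) (allTypes Δ)

typeOf∈allTypes : ∀ Δ v → typeOf Δ v ∈ allTypes Δ
typeOf∈allTypes []      v = here refl
typeOf∈allTypes (a ∷ Δ) v with beval v a
... | true  = ∈-++⁺ˡ (∈-map⁺ (true ∷_) (typeOf∈allTypes Δ v))
... | false = ∈-++⁺ʳ _ (∈-map⁺ (false ∷_) (typeOf∈allTypes Δ v))

S5-by-types : ∀ Δ → (∀ bs → S5 (conjLits Δ bs ⇒ᵖ χ)) → S5 χ
S5-by-types []      h = mp (h []) (taut λ _ → refl)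
S5-by-types (a ∷ Δ) h = S5-by-types Δ λ bs → by-cases (h (true ∷ bs)) (h (false ∷ bs))

module _ (em : ExcludedMiddle (lsuc 0ℓ)) where

  decide : (P : Set) → Dec P
  decide P = map′ lower lift em

  S5-complete : ∀ Δ → (∀ v → Consistent Δ v → T (beval v χ)) → S5 χ
  S5-complete {χ} Δ h = S5-by-types Δ by-type
    where
    by-type : ∀ bs → S5 (conjLits Δ bs ⇒ᵖ χ)
    by-type bs with decide (S5 (¬ᵖ conjLits Δ bs))
    ... | yes inconsistent = exfalso inconsistent
    ... | no  consistent   = taut λ v → to T-≡ (from T-⇒ᵇ λ t →
          h v (subst (λ bs → ¬ S5 (¬ᵖ conjLits Δ bs)) (sym (conjLits-true Δ bs t)) consistent))

atoms : PForm → List PForm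
atoms (p i)    = p i ∷ []
atoms ⊥ᵖ       = []
atoms (¬ᵖ φ)   = atoms φ
atoms (φ ∧ᵖ ψ) = atoms φ ++ atoms ψ
atoms (φ ∨ᵖ ψ) = atoms φ ++ atoms ψ
atoms (φ ⇒ᵖ ψ) = atoms φ ++ atoms ψ
atoms (□ᵖ φ)   = □ᵖ φ ∷ []
atoms (◇ᵖ φ)   = ◇ᵖ φ ∷ []

beval-cong : ∀ φ → (∀ {a} → a ∈ atoms φ → beval v a ≡ beval v′ a) → beval v φ ≡ beval v′ φ
beval-cong (p i)    h = h (here refl)
beval-cong ⊥ᵖ       h = refl
beval-cong (¬ᵖ φ)   h = cong not (beval-cong φ h)
beval-cong (φ ∧ᵖ ψ) h = cong₂ _∧_ (beval-cong φ (h ∘ ∈-++⁺ˡ)) (beval-cong ψ (h ∘ ∈-++⁺ʳ (atoms φ)))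
beval-cong (φ ∨ᵖ ψ) h = cong₂ _∨_ (beval-cong φ (h ∘ ∈-++⁺ˡ)) (beval-cong ψ (h ∘ ∈-++⁺ʳ (atoms φ)))
beval-cong (φ ⇒ᵖ ψ) h = cong₂ _⇒ᵇ_ (beval-cong φ (h ∘ ∈-++⁺ˡ)) (beval-cong ψ (h ∘ ∈-++⁺ʳ (atoms φ)))
beval-cong (□ᵖ φ)   h = h (here refl)
beval-cong (◇ᵖ φ)   h = h (here refl)

typeOf-agree : ∀ Δ → typeOf Δ v ≡ typeOf Δ v′ → a ∈ Δ → beval v a ≡ beval v′ a
typeOf-agree (a ∷ Δ) e (here refl) = proj₁ (∷-injective e)
typeOf-agree (a ∷ Δ) e (there a∈Δ) = typeOf-agree Δ (proj₂ (∷-injective e)) a∈Δ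

typeOf-beval : typeOf Δ v ≡ typeOf Δ v′ → atoms φ ⊆ Δ → beval v φ ≡ beval v′ φ
typeOf-beval {Δ} {φ = φ} e φ⊆Δ = beval-cong φ (typeOf-agree Δ e ∘ φ⊆Δ)

S5-sound-at-consistent : Consistent Δ v → S5 θ → atoms θ ⊆ Δ → T (beval v θ)
S5-sound-at-consistent {Δ} {v} {θ} consistent ⊢θ θ⊆Δ =
  T-stable _ λ ¬vθ → consistent (refute (taut (other-types-refute ¬vθ)) ⊢θ)
  where
  other-types-refute : ¬ T (beval v θ) → Tautology (conjLits Δ (typeOf Δ v) ⇒ᵖ ¬ᵖ θ)
  other-types-refute ¬vθ v′ = to T-≡ (from T-⇒ᵇ λ t → from T-not λ v′θ →
    ¬vθ (subst T (typeOf-beval {Δ} {φ = θ} (conjLits-true Δ _ t) θ⊆Δ) v′θ))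

boxes : List PForm → List PForm
boxes = map □ᵖ

withBoxes : List PForm → List PForm
withBoxes Γ = Γ ++ boxes Γ

□∈withBoxes : φ ∈ Γ → □ᵖ φ ∈ withBoxes Γ
□∈withBoxes {Γ = Γ} = ∈-++⁺ʳ Γ ∘ ∈-map⁺ □ᵖ

conjLits-boxes-⇒□ : ∀ Γ bs → S5 (conjLits (boxes Γ) bs ⇒ᵖ □ᵖ (conjLits (boxes Γ) bs))
conjLits-boxes-⇒□ []      []           = weaken (nec (taut λ _ → refl))
conjLits-boxes-⇒□ []      (_ ∷ _)      = taut λ _ → refl
conjLits-boxes-⇒□ (_ ∷ _) []           = taut λ _ → refl
conjLits-boxes-⇒□ (χ ∷ Γ) (true ∷ bs)  = ⇒□-∧ ax4 (conjLits-boxes-⇒□ Γ bs)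
conjLits-boxes-⇒□ (χ ∷ Γ) (false ∷ bs) = ⇒□-∧ ax5 (conjLits-boxes-⇒□ Γ bs)

atoms-conjLits-boxes : ∀ Γ bs → atoms (conjLits (boxes Γ) bs) ⊆ boxes Γ
atoms-conjLits-boxes []      []           ()
atoms-conjLits-boxes []      (_ ∷ _)      ()
atoms-conjLits-boxes (_ ∷ _) []           ()
atoms-conjLits-boxes (χ ∷ Γ) (true ∷ bs)  = ∈-∷⁺ʳ (here refl) (xs⊆x∷xs _ _ ∘ atoms-conjLits-boxes Γ bs)
atoms-conjLits-boxes (χ ∷ Γ) (false ∷ bs) = ∈-∷⁺ʳ (here refl) (xs⊆x∷xs _ _ ∘ atoms-conjLits-boxes Γ bs)

-- If there were no such w′, the box type of w would S5-imply φ; as a conjunction of boxes and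
-- negated boxes it implies its own box (ax4, ax5), hence it would imply □φ, which w satisfies.
□-witness : ExcludedMiddle (lsuc 0ℓ) → ∀ Γ →
            Consistent (withBoxes Γ) w → φ ∈ Γ → atoms φ ⊆ withBoxes Γ → ¬ T (beval w (□ᵖ φ)) →
            Σ Valuation λ w′ → Consistent (withBoxes Γ) w′ × typeOf (boxes Γ) w′ ≡ typeOf (boxes Γ) w
                             × ¬ T (beval w′ φ)
□-witness {w} {φ} em Γ w-consistent φ∈Γ φ⊆ ¬w□φ
  with decide em (Σ Valuation λ w′ → Consistent (withBoxes Γ) w′
                                   × typeOf (boxes Γ) w′ ≡ typeOf (boxes Γ) w × ¬ T (beval w′ φ))
... | yes found = found
... | no  none  = ⊥-elim (¬w□φ (to T-⇒ᵇ (S5-sound-at-consistent w-consistent boxType⇒□φ atoms⊆)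
                                         (conjLits-typeOf w (boxes Γ))))
  where
  boxType : PForm
  boxType = conjLits (boxes Γ) (typeOf (boxes Γ) w)

  boxType⇒φ : S5 (boxType ⇒ᵖ φ)
  boxType⇒φ = S5-complete em (withBoxes Γ) λ v v-consistent → from T-⇒ᵇ λ t → T-stable _ λ ¬vφ →
    none (v , v-consistent , conjLits-true (boxes Γ) _ t , ¬vφ)

  boxType⇒□φ : S5 (boxType ⇒ᵖ □ᵖ φ)
  boxType⇒□φ = ⇒-trans (conjLits-boxes-⇒□ Γ _) (□-mono boxType⇒φ)

  atoms⊆ : atoms (boxType ⇒ᵖ □ᵖ φ) ⊆ withBoxes Γ
  atoms⊆ = ++-⊆ (∈-++⁺ʳ Γ ∘ atoms-conjLits-boxes Γ _) (∈-∷⁺ʳ (□∈withBoxes φ∈Γ) (λ ()))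

closure : PForm → List PForm
closure (p i)    = p i ∷ []
closure ⊥ᵖ       = []
closure (¬ᵖ φ)   = closure φ
closure (φ ∧ᵖ ψ) = closure φ ++ closure ψ
closure (φ ∨ᵖ ψ) = closure φ ++ closure ψ
closure (φ ⇒ᵖ ψ) = closure φ ++ closure ψ
closure (□ᵖ φ)   = φ ∷ closure φ
closure (◇ᵖ φ)   = ◇ᵖ φ ∷ ¬ᵖ φ ∷ closure φ

atoms⊆withBoxes : ∀ φ → closure φ ⊆ Γ → atoms φ ⊆ withBoxes Γ
atoms⊆withBoxes (p i)    c = ∈-∷⁺ʳ (∈-++⁺ˡ (c (here refl))) (λ ())
atoms⊆withBoxes ⊥ᵖ       c = λ ()
atoms⊆withBoxes (¬ᵖ φ)   c = atoms⊆withBoxes φ c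
atoms⊆withBoxes (φ ∧ᵖ ψ) c =
  ++-⊆ (atoms⊆withBoxes φ (c ∘ ∈-++⁺ˡ)) (atoms⊆withBoxes ψ (c ∘ ∈-++⁺ʳ (closure φ)))
atoms⊆withBoxes (φ ∨ᵖ ψ) c =
  ++-⊆ (atoms⊆withBoxes φ (c ∘ ∈-++⁺ˡ)) (atoms⊆withBoxes ψ (c ∘ ∈-++⁺ʳ (closure φ)))
atoms⊆withBoxes (φ ⇒ᵖ ψ) c =
  ++-⊆ (atoms⊆withBoxes φ (c ∘ ∈-++⁺ˡ)) (atoms⊆withBoxes ψ (c ∘ ∈-++⁺ʳ (closure φ)))
atoms⊆withBoxes (□ᵖ φ)   c = ∈-∷⁺ʳ (□∈withBoxes (c (here refl))) (λ ())
atoms⊆withBoxes (◇ᵖ φ)   c = ∈-∷⁺ʳ (∈-++⁺ˡ (c (here refl))) (λ ())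

-- Counting elements by plain sentences

Chain : ℕ → LinOrd
Chain n = record { Carrier = Fin (suc n) ; _≤_ = Fin._≤_ ; isTotalOrder = ≤-isTotalOrder }

toBottom : (V : LinOrd) (n : ℕ) → Mono V (Chain n)
toBottom V n = record { fun = λ _ → zero ; mono = λ _ → z≤n }

module _ {C : Set} where

  ⊤' : ∀ {n} → Form C n
  ⊤' = ¬' ⊥'

  -- Under ∃', var zero is the new element y and var (suc zero) the previous one x, so
  -- descending k holds at x iff there is a chain x > y₁ > ⋯ > y_k.
  descending : ℕ → ∀ {n} → Form C (suc n)
  descending zero    = ⊤'
  descending (suc k) = ∃' ((¬' (var (suc zero) ≤' var zero)) ∧' descending k)

  moreThan : ℕ → Form C 0
  moreThan m = ∃' (descending m)

  boolSentence : Bool → Form C 0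
  boolSentence true  = ⊤'
  boolSentence false = ⊥'

  descending-plain : ∀ k {n} → Plain (descending k {n})
  descending-plain zero    = ¬-p ⊥-p
  descending-plain (suc k) = ∃-p (∧-p (¬-p (≤-p (var _) (var _))) (descending-plain k))

  moreThan-plain : ∀ m → Plain (moreThan m)
  moreThan-plain m = ∃-p (descending-plain m)

  boolSentence-plain : ∀ b → Plain (boolSentence b)
  boolSentence-plain true  = ¬-p ⊥-p
  boolSentence-plain false = ⊥-p

module _ (W : LinOrd) where

  boolSentence-sat : ∀ b {V g ν} → Sat W V g (boolSentence b) ν ⇔ T b
  boolSentence-sat true  = mk⇔ (λ _ → tt) (λ _ ())
  boolSentence-sat false = mk⇔ lower ⊥-elim

  descending-cong : ∀ k {V g m m′} {ν : Fin (suc m) → Carrier V} {ν′ : Fin (suc m′) → Carrier V} →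
                    ν zero ≡ ν′ zero → Sat W V g (descending k) ν → Sat W V g (descending k) ν′
  descending-cong zero    e s                    = s
  descending-cong (suc k) {V} e (y , x≰y , s) =
    y , subst (λ x → ¬ Lift _ (LinOrd._≤_ V x y)) e x≰y , descending-cong k refl s

  moreThan-cong : ∀ m {V g} (ν ν′ : Fin 0 → Carrier V) →
                  Sat W V g (moreThan m) ν → Sat W V g (moreThan m) ν′
  moreThan-cong m ν ν′ (x , s) = x , descending-cong m refl s

  descending-Chain : ∀ k {n m} {h : Mono W (Chain n)} (ν : Fin (suc m) → Fin (suc n)) →
                     Sat W (Chain n) h (descending k) ν ⇔ k ≤ toℕ (ν zero)
  descending-Chain k ν = mk⇔ (bounded k ν) (realized k ν)
    where
    bounded : ∀ k {m} (ν : Fin (suc m) → Fin _) → Sat W _ _ (descending k) ν → k ≤ toℕ (ν zero)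
    bounded zero    ν _             = z≤n
    bounded (suc k) ν (y , x≰y , s) = <-≤-trans (s≤s (bounded k _ s)) (≰⇒> (x≰y ∘ lift))

    realized : ∀ k {m} (ν : Fin (suc m) → Fin _) → k ≤ toℕ (ν zero) → Sat W _ _ (descending k) ν
    realized zero    ν _   ()
    realized (suc k) ν k<x = y , x≰y , realized k _ (≤-reflexive (sym (toℕ-fromℕ< k<1+n)))
      where
      k<1+n = <-trans k<x (toℕ<n (ν zero))
      y     = fromℕ< k<1+n
      x≰y : ¬ Lift _ (toℕ (ν zero) ≤ toℕ y)
      x≰y (lift x≤y) = <⇒≱ k<x (≤-trans x≤y (≤-reflexive (toℕ-fromℕ< k<1+n)))

  moreThan-Chain : ∀ m {n} {h : Mono W (Chain n)} (ν : Fin 0 → Fin (suc n)) →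
                   Sat W (Chain n) h (moreThan m) ν ⇔ m ≤ n
  moreThan-Chain m {n} ν = mk⇔
    (λ (x , s) → ≤-trans (to (descending-Chain m _) s) (toℕ≤pred[n] x))
    (λ m≤n → fromℕ n , from (descending-Chain m _) (subst (m ≤_) (sym (toℕ-fromℕ n)) m≤n))

module Classes (em : ExcludedMiddle (lsuc 0ℓ)) (W : LinOrd) where

  -- The number of elements of V minus one, capped at K (the empty order also has class 0).
  classOf : (K : ℕ) (V : LinOrd) → Mono W V → (Fin 0 → Carrier V) → Fin (suc K)
  classOf zero    V g ν = zero
  classOf (suc K) V g ν with em {Sat W V g (moreThan (suc K)) ν}
  ... | yes _ = fromℕ (suc K)
  ... | no  _ = inject₁ (classOf K V g ν)

  classOf-cong : ∀ K {V g} (ν ν′ : Fin 0 → Carrier V) → classOf K V g ν ≡ classOf K V g ν′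
  classOf-cong zero    ν ν′ = refl
  classOf-cong (suc K) {V} {g} ν ν′
    with em {Sat W V g (moreThan (suc K)) ν} | em {Sat W V g (moreThan (suc K)) ν′}
  ... | yes _    | yes _    = refl
  ... | no  _    | no  _    = cong inject₁ (classOf-cong K ν ν′)
  ... | yes more | no ¬more = ⊥-elim (¬more (moreThan-cong W (suc K) ν ν′ more))
  ... | no ¬more | yes more = ⊥-elim (¬more (moreThan-cong W (suc K) ν′ ν more))

  toℕ-classOf-Chain : ∀ K {n h} (ν : Fin 0 → Fin (suc n)) → n ≤ K → toℕ (classOf K (Chain n) h ν) ≡ n
  toℕ-classOf-Chain zero    ν z≤n = refl
  toℕ-classOf-Chain (suc K) {n} {h} ν n≤1+K with em {Sat W (Chain n) h (moreThan (suc K)) ν}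
  ... | yes more = trans (toℕ-fromℕ (suc K)) (≤-antisym (to (moreThan-Chain W (suc K) ν) more) n≤1+K)
  ... | no ¬more = trans (toℕ-inject₁ _) (toℕ-classOf-Chain K ν n≤K)
    where
    n≤K = s≤s⁻¹ (≰⇒> (¬more ∘ from (moreThan-Chain W (suc K) ν)))

  classOf-Chain : ∀ K (s : Fin (suc K)) {h} ν → classOf K (Chain (toℕ s)) h ν ≡ s
  classOf-Chain K s ν = toℕ-injective (toℕ-classOf-Chain K ν (toℕ≤pred[n] s))

  atClass : (K : ℕ) → (Fin (suc K) → Bool) → Sentence W
  atClass zero    β = boolSentence (β zero)
  atClass (suc K) β = (moreThan (suc K) ∧' boolSentence (β (fromℕ (suc K))))
                   ∨' ((¬' moreThan (suc K)) ∧' atClass K (β ∘ inject₁))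

  atClass-plain : ∀ K β → Plain (atClass K β)
  atClass-plain zero    β = boolSentence-plain (β zero)
  atClass-plain (suc K) β = ∨-p (∧-p (moreThan-plain _) (boolSentence-plain _))
                                (∧-p (¬-p (moreThan-plain _)) (atClass-plain K _))

  atClass-sat : ∀ K β {V g ν} → Sat W V g (atClass K β) ν ⇔ T (β (classOf K V g ν))
  atClass-sat zero    β = boolSentence-sat W (β zero)
  atClass-sat (suc K) β {V} {g} {ν} with em {Sat W V g (moreThan (suc K)) ν}
  ... | yes more = mk⇔
    (λ { (inj₁ (_ , s)) → to (boolSentence-sat W _) s ; (inj₂ (¬more , _)) → ⊥-elim (¬more more) })
    (λ t → inj₁ (more , from (boolSentence-sat W _) t))
  ... | no ¬more = mk⇔
    (λ { (inj₁ (more , _)) → ⊥-elim (¬more more) ; (inj₂ (_ , s)) → to (atClass-sat K (β ∘ inject₁)) s })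
    (λ t → inj₂ (¬more , from (atClass-sat K (β ∘ inject₁)) t))

-- The canonical cluster realized over linear orders

module Cluster (em : ExcludedMiddle (lsuc 0ℓ)) (Γ : List PForm) (v₀ : Valuation)
               (v₀-consistent : Consistent (withBoxes Γ) v₀) where

  Γ⁺ : List PForm
  Γ⁺ = withBoxes Γ

  InCluster : Valuation → Set
  InCluster w = Consistent Γ⁺ w × typeOf (boxes Γ) w ≡ typeOf (boxes Γ) v₀

  □-constant : ∀ {w w′} → InCluster w → InCluster w′ → φ ∈ Γ → beval w (□ᵖ φ) ≡ beval w′ (□ᵖ φ)
  □-constant (_ , e) (_ , e′) φ∈Γ = typeOf-agree (boxes Γ) (trans e (sym e′)) (∈-map⁺ □ᵖ φ∈Γ)

  □-witness-in-cluster : InCluster w → φ ∈ Γ → atoms φ ⊆ Γ⁺ → ¬ T (beval w (□ᵖ φ)) →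
                         Σ Valuation λ w′ → InCluster w′ × ¬ T (beval w′ φ)
  □-witness-in-cluster (w-consistent , e) φ∈Γ φ⊆Γ⁺ ¬w□φ =
    let w′ , w′-consistent , e′ , ¬w′φ = □-witness em Γ w-consistent φ∈Γ φ⊆Γ⁺ ¬w□φ
    in  w′ , (w′-consistent , trans e′ e) , ¬w′φ

  ◇-as-¬□¬ : InCluster w → ◇ᵖ φ ∈ Γ → ¬ᵖ φ ∈ Γ → T (beval w (◇ᵖ φ)) ⇔ (¬ T (beval w (□ᵖ (¬ᵖ φ))))
  ◇-as-¬□¬ (w-consistent , _) ◇φ∈Γ ¬φ∈Γ = mk⇔
    (to T-not ∘ to T-⇒ᵇ (S5-sound-at-consistent w-consistent dual₁ (∈-∷⁺ʳ ◇φ∈Γ⁺ (∈-∷⁺ʳ □¬φ∈Γ⁺ λ ()))))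
    (to T-⇒ᵇ (S5-sound-at-consistent w-consistent dual₂ (∈-∷⁺ʳ □¬φ∈Γ⁺ (∈-∷⁺ʳ ◇φ∈Γ⁺ λ ()))) ∘ from T-not)
    where
    ◇φ∈Γ⁺  = ∈-++⁺ˡ ◇φ∈Γ
    □¬φ∈Γ⁺ = □∈withBoxes ¬φ∈Γ

  types : List (List Bool)
  types = allTypes Γ⁺

  K : ℕ
  K = length types

  realize : List Bool → Valuation
  realize bs with decide em (Σ Valuation λ w → InCluster w × typeOf Γ⁺ w ≡ bs)
  ... | yes (w , _) = w
  ... | no  _       = v₀

  realize-inCluster : ∀ bs → InCluster (realize bs)
  realize-inCluster bs with decide em (Σ Valuation λ w → InCluster w × typeOf Γ⁺ w ≡ bs)
  ... | yes (_ , w∈ , _) = w∈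
  ... | no  _            = v₀-consistent , refl

  realize-typeOf : InCluster w → typeOf Γ⁺ (realize (typeOf Γ⁺ w)) ≡ typeOf Γ⁺ w
  realize-typeOf {w} w∈ with decide em (Σ Valuation λ w′ → InCluster w′ × typeOf Γ⁺ w′ ≡ typeOf Γ⁺ w)
  ... | yes (_ , _ , e) = e
  ... | no  none        = ⊥-elim (none (w , w∈ , refl))

  clusterWorld : Fin (suc K) → Valuation
  clusterWorld zero    = v₀
  clusterWorld (suc i) = realize (lookup types i)

  clusterWorld-inCluster : ∀ s → InCluster (clusterWorld s)
  clusterWorld-inCluster zero    = v₀-consistent , refl
  clusterWorld-inCluster (suc i) = realize-inCluster _

  clusterWorld-covers : InCluster w → Σ (Fin (suc K)) λ s → typeOf Γ⁺ (clusterWorld s) ≡ typeOf Γ⁺ w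
  clusterWorld-covers {w} w∈ =
    suc (index w-type∈) ,
    subst (λ bs → typeOf Γ⁺ (realize bs) ≡ typeOf Γ⁺ w) (lookup-index w-type∈) (realize-typeOf w∈)
    where
    w-type∈ = typeOf∈allTypes Γ⁺ w

  module Assignment (W : LinOrd) where

    open Classes em W

    classW : Fin (suc K)
    classW = classOf K W (idMono W) (λ ())

    -- Exchanging the slots classW and zero makes W itself see v₀.
    worldAt : Fin (suc K) → Valuation
    worldAt = clusterWorld ∘ transpose classW zero

    worldOf : (V : LinOrd) → Mono W V → (Fin 0 → Carrier V) → Valuation
    worldOf V g ν = worldAt (classOf K V g ν)

    σ : ℕ → Sentence W
    σ i = atClass K λ s → worldAt s (p i)

    σ-plain : ∀ i → Plain (σ i)
    σ-plain i = atClass-plain K _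

    worldOf-W : ∀ ν → worldOf W (idMono W) ν ≡ v₀
    worldOf-W ν =
      trans (cong worldAt (classOf-cong K ν (λ ()))) (cong clusterWorld (transpose-self classW zero))

    worldOf-inCluster : ∀ V g ν → InCluster (worldOf V g ν)
    worldOf-inCluster V g ν = clusterWorld-inCluster (transpose classW zero (classOf K V g ν))

    worldOf-reaches : ∀ {V g ν} → InCluster w →
                      Σ LinOrd λ V′ → Σ (Mono V V′) λ f →
                        typeOf Γ⁺ (worldOf V′ (f ∘M g) (fun f ∘ ν)) ≡ typeOf Γ⁺ w
    worldOf-reaches {V = V} w∈ = Chain (toℕ t) , toBottom V (toℕ t) , (begin
        typeOf Γ⁺ (worldAt (classOf K (Chain (toℕ t)) _ _))
          ≡⟨ cong (typeOf Γ⁺ ∘ worldAt) (classOf-Chain K t _) ⟩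
        typeOf Γ⁺ (worldAt t)
          ≡⟨ cong (typeOf Γ⁺ ∘ clusterWorld) (transpose-inverse classW zero) ⟩
        typeOf Γ⁺ (clusterWorld s)
          ≡⟨ proj₂ (clusterWorld-covers w∈) ⟩
        typeOf Γ⁺ _
          ∎)
      where
      open ≡-Reasoning
      s = proj₁ (clusterWorld-covers w∈)
      t = transpose zero classW s

    □-spread : φ ∈ Γ → atoms φ ⊆ Γ⁺ → ∀ {V g ν} → T (beval (worldOf V g ν) (□ᵖ φ)) →
               ∀ V′ (f : Mono V V′) → T (beval (worldOf V′ (f ∘M g) (fun f ∘ ν)) φ)
    □-spread φ∈Γ φ⊆Γ⁺ {V} {g} {ν} t V′ f =
      to T-⇒ᵇ (S5-sound-at-consistent (proj₁ w′∈) axT (∈-∷⁺ʳ (□∈withBoxes φ∈Γ) φ⊆Γ⁺))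
              (subst T (□-constant (worldOf-inCluster V g ν) w′∈ φ∈Γ) t)
      where
      w′∈ = worldOf-inCluster V′ (f ∘M g) (fun f ∘ ν)

    □-counterexample : φ ∈ Γ → atoms φ ⊆ Γ⁺ → ∀ {V g ν} → ¬ T (beval (worldOf V g ν) (□ᵖ φ)) →
                       Σ LinOrd λ V′ → Σ (Mono V V′) λ f →
                         ¬ T (beval (worldOf V′ (f ∘M g) (fun f ∘ ν)) φ)
    □-counterexample {φ} φ∈Γ φ⊆Γ⁺ {V} {g} {ν} ¬t =
      let w′ , w′∈ , ¬w′φ = □-witness-in-cluster (worldOf-inCluster V g ν) φ∈Γ φ⊆Γ⁺ ¬t
          V′ , f , e      = worldOf-reaches {V = V} {g = g} {ν = ν} w′∈
      in  V′ , f , ¬w′φ ∘ subst T (typeOf-beval {φ = φ} e φ⊆Γ⁺)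

    □-semantics : φ ∈ Γ → atoms φ ⊆ Γ⁺ → ∀ {V g ν} →
                  T (beval (worldOf V g ν) (□ᵖ φ))
                  ⇔ (∀ V′ (f : Mono V V′) → T (beval (worldOf V′ (f ∘M g) (fun f ∘ ν)) φ))
    □-semantics φ∈Γ φ⊆Γ⁺ = mk⇔ (□-spread φ∈Γ φ⊆Γ⁺) λ everywhere → T-stable _ λ ¬t →
      let V′ , f , ¬t′ = □-counterexample φ∈Γ φ⊆Γ⁺ ¬t in ¬t′ (everywhere V′ f)

    ◇-semantics : ◇ᵖ φ ∈ Γ → ¬ᵖ φ ∈ Γ → atoms φ ⊆ Γ⁺ → ∀ {V g ν} →
                  T (beval (worldOf V g ν) (◇ᵖ φ))
                  ⇔ (Σ LinOrd λ V′ → Σ (Mono V V′) λ f → T (beval (worldOf V′ (f ∘M g) (fun f ∘ ν)) φ))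
    ◇-semantics ◇φ∈Γ ¬φ∈Γ φ⊆Γ⁺ {V} {g} {ν} = mk⇔
      (λ t → let V′ , f , ¬t′ = □-counterexample ¬φ∈Γ φ⊆Γ⁺ (to ◇⇔¬□¬ t)
             in  V′ , f , T-stable _ (¬t′ ∘ from T-not))
      (λ (V′ , f , t) → from ◇⇔¬□¬ λ □¬ → to T-not (□-spread ¬φ∈Γ φ⊆Γ⁺ □¬ V′ f) t)
      where
      ◇⇔¬□¬ = ◇-as-¬□¬ (worldOf-inCluster V g ν) ◇φ∈Γ ¬φ∈Γ

    truth : ∀ φ → closure φ ⊆ Γ → ∀ {V g ν} → Sat W V g (substP σ φ) ν ⇔ T (beval (worldOf V g ν) φ)
    truth (p i)    _ = atClass-sat K _
    truth ⊥ᵖ       _ = mk⇔ lower ⊥-elim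
    truth (¬ᵖ φ)   c = ⇔-sym T-not ⇔-∘ ¬-cong-⇔ (truth φ c)
    truth (φ ∧ᵖ ψ) c = ⇔-sym T-∧ ⇔-∘ (truth φ (c ∘ ∈-++⁺ˡ) ×-⇔ truth ψ (c ∘ ∈-++⁺ʳ (closure φ)))
    truth (φ ∨ᵖ ψ) c = ⇔-sym T-∨ ⇔-∘ (truth φ (c ∘ ∈-++⁺ˡ) ⊎-⇔ truth ψ (c ∘ ∈-++⁺ʳ (closure φ)))
    truth (φ ⇒ᵖ ψ) c = ⇔-sym T-⇒ᵇ ⇔-∘ →-cong-⇔ (truth φ (c ∘ ∈-++⁺ˡ)) (truth ψ (c ∘ ∈-++⁺ʳ (closure φ)))
    truth (□ᵖ φ)   c = ⇔-sym (□-semantics (c (here refl)) (atoms⊆withBoxes φ c′)) ⇔-∘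
                       mk⇔ (λ s V′ f → to (truth φ c′) (s V′ f)) (λ t V′ f → from (truth φ c′) (t V′ f))
      where
      c′ : closure φ ⊆ Γ
      c′ = c ∘ there
    truth (◇ᵖ φ)   c = ⇔-sym (◇-semantics (c (here refl)) (c (there (here refl))) (atoms⊆withBoxes φ c′)) ⇔-∘
                       mk⇔ (map₂ (map₂ (to (truth φ c′)))) (map₂ (map₂ (from (truth φ c′))))
      where
      c′ : closure φ ⊆ Γ
      c′ = c ∘ there ∘ there

plain-refutation : ExcludedMiddle (lsuc 0ℓ) → (W : LinOrd) → ∀ ψ → ¬ S5 ψ →
                   Σ (ℕ → Sentence W) λ σ → (∀ i → Plain (σ i)) × ¬ HoldsAt W (substP σ ψ)
plain-refutation em W ψ ψ∉S5
  with decide em (Σ Valuation λ v → Consistent (withBoxes (closure ψ)) v × ¬ T (beval v ψ))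
... | no none =
  ⊥-elim (ψ∉S5 (S5-complete em _ λ v v-consistent → T-stable _ λ ¬vψ → none (v , v-consistent , ¬vψ)))
... | yes (v₀ , v₀-consistent , ¬v₀ψ) =
  σ , σ-plain , λ holds → ¬v₀ψ (subst (λ w → T (beval w ψ)) (worldOf-W _) (to (truth ψ ⊆-refl) holds))
  where
  open Cluster em (closure ψ) v₀ v₀-consistent
  open Assignment W

theorem7p2 : ExcludedMiddle (lsuc 0ℓ) →
    (W : LinOrd) → Carrier W →
    (L : Sentence W → Set) → ((φ : Sentence W) → Plain φ → L φ) →
    (ψ : PForm) → Val W L ψ → S5 ψ
theorem7p2 em W _ L plain⊆L ψ valid = decidable-stable (decide em (S5 ψ)) λ ψ∉S5 →
  let σ , σ-plain , refuted = plain-refutation em W ψ ψ∉S5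
  in  refuted (valid σ λ i → plain⊆L (σ i) (σ-plain i))
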